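{- There is an algorithm that tests whether two given vertices $u,v$ of a simple graph on $n$ vertices are adjacent using $1$ shortest path query, but any algorithm for this problem requires $\Omega(n)$ effective resistance queries.
   Context: The graph is hidden on a known vertex set, unweighted. An effective resistance query on $x,y$ returns $R(x,y)=(\mathbf{1}_x-\mathbf{1}_y)^TL^+(\mathbf{1}_x-\mathbf{1}_y)$, where $L$ is the Laplacian of the graph and $L^+$ its pseudoinverse. A shortest path query on $x,y$ returns the length of a shortest $x$–$y$ path. -}

module Defs where

import Data.Fin

open import Data.Bool using (Bool; true; false; if_then_else_)
open import Data.Nat using (ℕ; zero; suc; _≤_; _<_)
open import Data.Fin using (Fin; _≟_)
open import Relation.Nullary using (yes; no)
open import Data.Maybe using (Maybe; just; nothing)
open import Data.Product using (Σ; ∃; _×_; _,_)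
open import Data.Rational using (ℚ; 0ℚ; 1ℚ; _+_; _*_; _-_)
open import Function.Bundles using (_⇔_)
open import Relation.Binary.PropositionalEquality using (_≡_)
open import Relation.Nullary using (¬_)

record SimpleGraph (n : ℕ) : Set where
  field
    adj   : Fin n → Fin n → Bool
    sym   : ∀ x y → adj x y ≡ adj y x
    loopless : ∀ x → adj x x ≡ false
open SimpleGraph public

Adjacent : ∀ {n} → SimpleGraph n → Fin n → Fin n → Set
Adjacent G x y = adj G x y ≡ true

sumFin : (n : ℕ) → (Fin n → ℚ) → ℚ
sumFin zero    f = 0ℚ
sumFin (suc n) f = f Data.Fin.zero + sumFin n (λ i → f (Data.Fin.suc i))

Matrix : ℕ → Set
Matrix n = Fin n → Fin n → ℚ

infixl 7 _⊗_
_⊗_ : ∀ {n} → Matrix n → Matrix n → Matrix n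
_⊗_ {n} A B i j = sumFin n (λ k → A i k * B k j)

transpose : ∀ {n} → Matrix n → Matrix n
transpose A i j = A j i

-- equality of matrices (entrywise; ℚ is normalised so ≡ is the right equality)
infix 4 _≐_
_≐_ : ∀ {n} → Matrix n → Matrix n → Set
A ≐ B = ∀ i j → A i j ≡ B i j

indicator : Bool → ℚ
indicator b = if b then 1ℚ else 0ℚ

degree : ∀ {n} → SimpleGraph n → Fin n → ℚ
degree {n} G x = sumFin n (λ y → indicator (adj G x y))

laplacian : ∀ {n} → SimpleGraph n → Matrix n
laplacian G i j with i ≟ j
... | yes _ = degree G i
... | no  _ = 0ℚ - indicator (adj G i j)

-- M is the Moore–Penrose pseudoinverse of L (the four Penrose equations;
-- over ℚ ⊆ ℝ conjugate transpose is transpose)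
IsPseudoinverse : ∀ {n} → Matrix n → Matrix n → Set
IsPseudoinverse L M =
  ((L ⊗ M) ⊗ L ≐ L) × ((M ⊗ L) ⊗ M ≐ M) ×
  (transpose (L ⊗ M) ≐ (L ⊗ M)) × (transpose (M ⊗ L) ≐ (M ⊗ L))

-- (1_x - 1_y)^T M (1_x - 1_y) = M x x - M x y - M y x + M y y
quadDiff : ∀ {n} → Matrix n → Fin n → Fin n → ℚ
quadDiff M x y = ((M x x - M x y) - M y x) + M y y

EffectiveResistance : ∀ {n} → SimpleGraph n → Fin n → Fin n → ℚ → Set
EffectiveResistance G x y r =
  Σ (Matrix _) λ M → IsPseudoinverse (laplacian G) M × (r ≡ quadDiff M x y)

data Walk {n} (G : SimpleGraph n) : Fin n → Fin n → ℕ → Set where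
  here : ∀ {x} → Walk G x x zero
  step : ∀ {x y z k} → Adjacent G x y → Walk G y z k → Walk G x z (suc k)

ShortestPath : ∀ {n} → SimpleGraph n → Fin n → Fin n → Maybe ℕ → Set
ShortestPath G x y (just d) = Walk G x y d × (∀ k → k < d → ¬ Walk G x y k)
ShortestPath G x y nothing  = ∀ k → ¬ Walk G x y k

-- Query algorithms as (adaptive) decision trees with answers in A

data Tree (n : ℕ) (A : Set) : Set where
  leaf  : Bool → Tree n A
  query : Fin n → Fin n → (A → Tree n A) → Tree n A

Oracle : ℕ → Set → Set₁
Oracle n A = Fin n → Fin n → A → Set

data Run {n A} (O : Oracle n A) : Tree n A → ℕ → Bool → Set where
  done : ∀ {b} → Run O (leaf b) zero b
  ask  : ∀ {x y f a k b} → O x y a → Run O (f a) k b → Run O (query x y f) (suc k) b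

TestsAdjacency : ∀ {n A} → (SimpleGraph n → Oracle n A) →
                 ℕ → (Fin n → Fin n → Tree n A) → Set
TestsAdjacency {n} oracle k T =
  ∀ (G : SimpleGraph n) (u v : Fin n) →
    (∃ λ j → ∃ λ b → Run (oracle G) (T u v) j b) ×
    (∀ j b → Run (oracle G) (T u v) j b → j ≤ k × ((b ≡ true) ⇔ Adjacent G u v))

SPOracle : ∀ {n} → SimpleGraph n → Oracle n (Maybe ℕ)
SPOracle = ShortestPath

EROracle : ∀ {n} → SimpleGraph n → Oracle n ℚ
EROracle = EffectiveResistance

-- A shortest-path query on (u, v) returns 1 exactly when u and v are adjacent; it always
-- has an answer, because a walk that repeats a vertex can be shortened, so if u and v are
-- connected at all then some walk between them has length below n.
--
-- For effective resistance, take two graphs on six vertices, one in which 0 and 1 are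
-- adjacent and one in which they are not, whose Laplacian pseudoinverses agree on the
-- {0, 1} × {0, 1} block.  Planting either gadget on u, v and four further vertices w
-- (all other vertices isolated) gives a graph whose L⁺ is the gadget's L⁺ padded with
-- zeros, so every resistance query avoiding w has the same answer in both graphs.  Run
-- against these common answers, the first k + 1 queries of an algorithm touch at most
-- 2(k + 1) vertices.  When n ≥ 2k + 8, four untouched vertices besides u and v remain, and
-- on the two graphs planted there an algorithm making at most k queries behaves
-- identically, although u and v are adjacent in only one of them.

module Submission where

open import Defs hiding (sym)
open import Algebra.Bundles using (CommutativeMonoid)
open import Data.Bool as Bool using (Bool; true; false; not; _∧_; _∨_)
open import Data.Bool.ListAction using (any; or)
open import Data.Bool.Properties using (∨-comm)
open import Data.Empty using (⊥)
open import Data.Fin as Fin using (Fin; zero; suc; _↑ˡ_)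
open import Data.Fin.Properties using (any?; all?; ¬∀⟶∃¬; pigeonhole; 0≢1+n; suc-injective; <⇒≢)
open import Data.Integer using (ℤ)
open import Data.List using (List; []; _∷_; length; lookup)
open import Data.List.Membership.Propositional using (_∈_; _∉_)
open import Data.List.Membership.Propositional.Properties using (∈-lookup)
open import Data.List.Properties using (map-cong)
open import Data.List.Relation.Unary.All using ([]; _∷_)
import Data.List.Relation.Unary.All as All
open import Data.List.Relation.Unary.All.Properties using (¬Any⇒All¬)
open import Data.List.Relation.Unary.AllPairs using ([]; _∷_)
open import Data.List.Relation.Unary.Any using (here; there; index)
open import Data.List.Relation.Unary.Any.Properties using (lookup-index)
open import Data.List.Relation.Unary.Unique.Propositional using (Unique)
open import Data.Maybe using (Maybe; just; nothing; map)
open import Data.Nat using (ℕ; zero; suc; NonZero; _+_; _*_; _≤_; _<_; _≤?_; _<?_; z≤n; s≤s)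
open import Data.Nat.Induction using (<-wellFounded)
open import Data.Nat.Properties
  using (≤-refl; ≤-trans; m≤m+n; m≤n+m; m≤n⇒m≤1+n; +-suc; *-suc; +-monoʳ-≤; *-monoˡ-≤;
         ≰⇒>; ≮⇒≥; ≤⇒≯; <⇒≤; m<1+n⇒m<n∨m≡n; module ≤-Reasoning)
open import Data.Product using (Σ; ∃; _×_; _,_; proj₁; proj₂)
open import Data.Rational as ℚ using (ℚ; 0ℚ; _/_)
open import Data.Rational.Properties using (+-identityˡ; *-zeroˡ; *-zeroʳ; +-0-commutativeMonoid)
open import Data.Sum using (_⊎_; inj₁; inj₂)
open import Data.Vec as Vec using (Vec; []; _∷_)
open import Data.Vec.Functional using (updateAt) renaming (_∷_ to _∷ᶠ_)
open import Data.Vec.Functional.Properties using (updateAt-updates; updateAt-minimal)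
open import Function using (_∘_; const; case_of_)
open import Function.Bundles using (_⇔_; Equivalence; mk⇔)
open import Function.Definitions using (Injective)
open import Induction.WellFounded using (Acc; acc)
open import Relation.Binary.Bundles using (Setoid)
open import Relation.Binary.PropositionalEquality
open import Relation.Nullary using (Dec; yes; no; ¬_; does; map′; _×-dec_; contradiction)
open import Relation.Nullary.Decidable using (does-⇔; dec-true; from-yes; decidable-stable)
open import Relation.Unary using (Decidable)
open import Algebra.Properties.CommutativeSemigroup
  (CommutativeMonoid.commutativeSemigroup +-0-commutativeMonoid) using (x∙yz≈y∙xz)

≡true-⇔⇒≡ : ∀ {b c} → (b ≡ true ⇔ c ≡ true) → b ≡ c
≡true-⇔⇒≡ {false} {false} _   = refl
≡true-⇔⇒≡ {false} {true}  b⇔c = Equivalence.from b⇔c refl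
≡true-⇔⇒≡ {true}  {false} b⇔c = sym (Equivalence.to b⇔c refl)
≡true-⇔⇒≡ {true}  {true}  _   = refl

sumFin-cong : ∀ n {f g : Fin n → ℚ} → (∀ i → f i ≡ g i) → sumFin n f ≡ sumFin n g
sumFin-cong zero    f≗g = refl
sumFin-cong (suc n) f≗g = cong₂ ℚ._+_ (f≗g zero) (sumFin-cong n (f≗g ∘ suc))

sumFin-zero : ∀ n {f : Fin n → ℚ} → (∀ i → f i ≡ 0ℚ) → sumFin n f ≡ 0ℚ
sumFin-zero zero    f≗0 = refl
sumFin-zero (suc n) f≗0 = cong₂ ℚ._+_ (f≗0 zero) (sumFin-zero n (f≗0 ∘ suc))

sumFin-extract : ∀ n (i : Fin n) (f : Fin n → ℚ) →
                 sumFin n f ≡ f i ℚ.+ sumFin n (updateAt f i (const 0ℚ))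
sumFin-extract (suc n) zero    f = cong (f zero ℚ.+_) (sym (+-identityˡ _))
sumFin-extract (suc n) (suc i) f = begin
  f zero ℚ.+ sumFin n (f ∘ suc)
    ≡⟨ cong (f zero ℚ.+_) (sumFin-extract n i (f ∘ suc)) ⟩
  f zero ℚ.+ (f (suc i) ℚ.+ sumFin n (updateAt (f ∘ suc) i (const 0ℚ)))
    ≡⟨ x∙yz≈y∙xz (f zero) (f (suc i)) _ ⟩
  f (suc i) ℚ.+ (f zero ℚ.+ sumFin n (updateAt (f ∘ suc) i (const 0ℚ))) ∎
  where open ≡-Reasoning

sumFin-image : ∀ {n} s (e : Fin s → Fin n) → Injective _≡_ _≡_ e → (f : Fin n → ℚ) →
               (∀ k → (∀ a → e a ≢ k) → f k ≡ 0ℚ) → sumFin n f ≡ sumFin s (f ∘ e)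
sumFin-image {n} zero    e _     f vanish = sumFin-zero n (λ k → vanish k λ ())
sumFin-image {n} (suc s) e e-inj f vanish = begin
  sumFin n f
    ≡⟨ sumFin-extract n (e zero) f ⟩
  f (e zero) ℚ.+ sumFin n f₀
    ≡⟨ cong (f (e zero) ℚ.+_) (sumFin-image s (e ∘ suc) (suc-injective ∘ e-inj) f₀ vanish₀) ⟩
  f (e zero) ℚ.+ sumFin s (f₀ ∘ e ∘ suc)
    ≡⟨ cong (f (e zero) ℚ.+_) (sumFin-cong s λ a → updateAt-minimal _ _ f (0≢1+n ∘ sym ∘ e-inj)) ⟩
  f (e zero) ℚ.+ sumFin s (f ∘ e ∘ suc) ∎
  where
  open ≡-Reasoning
  f₀ : Fin n → ℚ
  f₀ = updateAt f (e zero) (const 0ℚ)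
  vanish₀ : ∀ k → (∀ a → e (suc a) ≢ k) → f₀ k ≡ 0ℚ
  vanish₀ k k∉ with k Fin.≟ e zero
  ... | yes refl = updateAt-updates (e zero) f
  ... | no  k≢e₀ = trans (updateAt-minimal k (e zero) f k≢e₀)
                         (vanish k λ { zero → k≢e₀ ∘ sym ; (suc a) → k∉ a })

≐-setoid : ℕ → Setoid _ _
≐-setoid n = record
  { Carrier       = Matrix n
  ; _≈_           = _≐_
  ; isEquivalence = record
    { refl  = λ _ _ → refl
    ; sym   = λ A≐B i j → sym (A≐B i j)
    ; trans = λ A≐B B≐C i j → trans (A≐B i j) (B≐C i j)
    }
  }

module _ {n : ℕ} where

  open Setoid (≐-setoid n) using () renaming (refl to ≐-refl; sym to ≐-sym)

  ⊗-cong : {A A′ B B′ : Matrix n} → A ≐ A′ → B ≐ B′ → A ⊗ B ≐ A′ ⊗ B′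
  ⊗-cong A≐A′ B≐B′ i j = sumFin-cong n (λ k → cong₂ ℚ._*_ (A≐A′ i k) (B≐B′ k j))

  transpose-cong : {A B : Matrix n} → A ≐ B → transpose A ≐ transpose B
  transpose-cong A≐B i j = A≐B j i

  infix 4 _≐?_
  _≐?_ : (A B : Matrix n) → Dec (A ≐ B)
  A ≐? B = all? (λ i → all? (λ j → A i j ℚ.≟ B i j))

  isPseudoinverse? : (L M : Matrix n) → Dec (IsPseudoinverse L M)
  isPseudoinverse? L M =
    ((L ⊗ M) ⊗ L ≐? L) ×-dec ((M ⊗ L) ⊗ M ≐? M) ×-dec
    (transpose (L ⊗ M) ≐? L ⊗ M) ×-dec (transpose (M ⊗ L) ≐? M ⊗ L)

  IsPseudoinverse-respˡ : {L L′ M : Matrix n} → L ≐ L′ →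
                          IsPseudoinverse L M → IsPseudoinverse L′ M
  IsPseudoinverse-respˡ {L} {L′} {M} L≐L′ (LML , MLM , LM-sym , ML-sym) =
    LML′ , MLM′ , LM-sym′ , ML-sym′
    where
    open import Relation.Binary.Reasoning.Setoid (≐-setoid n)
    LM≐ : L′ ⊗ M ≐ L ⊗ M
    LM≐ = ⊗-cong (≐-sym L≐L′) ≐-refl
    ML≐ : M ⊗ L′ ≐ M ⊗ L
    ML≐ = ⊗-cong {A = M} ≐-refl (≐-sym L≐L′)
    LML′ : (L′ ⊗ M) ⊗ L′ ≐ L′
    LML′ = begin
      (L′ ⊗ M) ⊗ L′ ≈⟨ ⊗-cong LM≐ (≐-sym L≐L′) ⟩
      (L ⊗ M) ⊗ L   ≈⟨ LML ⟩
      L             ≈⟨ L≐L′ ⟩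
      L′            ∎
    MLM′ : (M ⊗ L′) ⊗ M ≐ M
    MLM′ = begin
      (M ⊗ L′) ⊗ M ≈⟨ ⊗-cong {B = M} ML≐ ≐-refl ⟩
      (M ⊗ L) ⊗ M  ≈⟨ MLM ⟩
      M            ∎
    LM-sym′ : transpose (L′ ⊗ M) ≐ L′ ⊗ M
    LM-sym′ = begin
      transpose (L′ ⊗ M) ≈⟨ transpose-cong LM≐ ⟩
      transpose (L ⊗ M)  ≈⟨ LM-sym ⟩
      L ⊗ M              ≈⟨ ≐-sym LM≐ ⟩
      L′ ⊗ M             ∎
    ML-sym′ : transpose (M ⊗ L′) ≐ M ⊗ L′
    ML-sym′ = begin
      transpose (M ⊗ L′) ≈⟨ transpose-cong ML≐ ⟩
      transpose (M ⊗ L)  ≈⟨ ML-sym ⟩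
      M ⊗ L              ≈⟨ ≐-sym ML≐ ⟩
      M ⊗ L′             ∎

laplacian-diagonal : ∀ {n} (G : SimpleGraph n) x → laplacian G x x ≡ degree G x
laplacian-diagonal G x with x Fin.≟ x
... | yes _   = refl
... | no  x≢x = contradiction refl x≢x

laplacian-offDiagonal : ∀ {n} (G : SimpleGraph n) {x y} → x ≢ y →
                        laplacian G x y ≡ 0ℚ ℚ.- indicator (adj G x y)
laplacian-offDiagonal G {x} {y} x≢y with x Fin.≟ y
... | yes x≡y = contradiction x≡y x≢y
... | no  _   = refl

entryOrZero : ∀ {s} → Matrix s → Maybe (Fin s) → Maybe (Fin s) → ℚ
entryOrZero N (just a) (just b) = N a b
entryOrZero N _        _        = 0ℚ

entryOrZero-⊗ : ∀ {s} (N N′ : Matrix s) p q →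
  sumFin s (λ c → entryOrZero N p (just c) ℚ.* entryOrZero N′ (just c) q) ≡ entryOrZero (N ⊗ N′) p q
entryOrZero-⊗ N N′ (just a) (just b) = refl
entryOrZero-⊗ N N′ (just a) nothing  = sumFin-zero _ (λ c → *-zeroʳ (N a c))
entryOrZero-⊗ N N′ nothing  q        = sumFin-zero _ (λ c → *-zeroˡ (entryOrZero N′ (just c) q))

entryOrZero-transpose : ∀ {s} (N : Matrix s) p q → entryOrZero N q p ≡ entryOrZero (transpose N) p q
entryOrZero-transpose N (just a) (just b) = refl
entryOrZero-transpose N (just a) nothing  = refl
entryOrZero-transpose N nothing  (just b) = refl
entryOrZero-transpose N nothing  nothing  = refl

entryOrZero-map : ∀ {r s} (f : Fin r → Fin s) (M : Matrix s) p q →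
                  entryOrZero M (map f p) (map f q) ≡ entryOrZero (λ a b → M (f a) (f b)) p q
entryOrZero-map f M (just a) (just b) = refl
entryOrZero-map f M (just a) nothing  = refl
entryOrZero-map f M nothing  q        = refl

entryOrZero-cong : ∀ {s} {M M′ : Matrix s} → M ≐ M′ → ∀ p q → entryOrZero M p q ≡ entryOrZero M′ p q
entryOrZero-cong M≐M′ (just a) (just b) = M≐M′ a b
entryOrZero-cong M≐M′ (just a) nothing  = refl
entryOrZero-cong M≐M′ nothing  q        = refl

adjOrFalse : ∀ {s} → SimpleGraph s → Maybe (Fin s) → Maybe (Fin s) → Bool
adjOrFalse H (just a) (just b) = adj H a b
adjOrFalse H _        _        = false

adjOrFalse-sym : ∀ {s} (H : SimpleGraph s) p q → adjOrFalse H p q ≡ adjOrFalse H q p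
adjOrFalse-sym H (just a) (just b) = SimpleGraph.sym H a b
adjOrFalse-sym H (just a) nothing  = refl
adjOrFalse-sym H nothing  (just b) = refl
adjOrFalse-sym H nothing  nothing  = refl

adjOrFalse-nothingʳ : ∀ {s} (H : SimpleGraph s) p → adjOrFalse H p nothing ≡ false
adjOrFalse-nothingʳ H (just a) = refl
adjOrFalse-nothingʳ H nothing  = refl

adjOrFalse-loopless : ∀ {s} (H : SimpleGraph s) p → adjOrFalse H p p ≡ false
adjOrFalse-loopless H (just a) = loopless H a
adjOrFalse-loopless H nothing  = refl

module Embedding {s n : ℕ} (e : Fin s → Fin n) (e-injective : Injective _≡_ _≡_ e) where

  preimage : Fin n → Maybe (Fin s)
  preimage x with any? (λ a → e a Fin.≟ x)
  ... | yes (a , _) = just a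
  ... | no  _       = nothing

  preimage-image : ∀ a → preimage (e a) ≡ just a
  preimage-image a with any? (λ b → e b Fin.≟ e a)
  ... | yes (b , eb≡ea) = cong just (e-injective eb≡ea)
  ... | no  ∄b          = contradiction (a , refl) ∄b

  image-preimage : ∀ {x a} → preimage x ≡ just a → e a ≡ x
  image-preimage {x} with any? (λ a → e a Fin.≟ x)
  ... | yes (a , ea≡x) = λ { refl → ea≡x }
  ... | no  _          = λ ()

  preimage-outside : ∀ {x} → (∀ a → e a ≢ x) → preimage x ≡ nothing
  preimage-outside {x} x∉e with any? (λ a → e a Fin.≟ x)
  ... | yes (a , ea≡x) = contradiction ea≡x (x∉e a)
  ... | no  _          = refl

  push : Matrix s → Matrix n
  push N x y = entryOrZero N (preimage x) (preimage y)

  pushGraph : SimpleGraph s → SimpleGraph n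
  pushGraph H = record
    { adj      = λ x y → adjOrFalse H (preimage x) (preimage y)
    ; sym      = λ x y → adjOrFalse-sym H (preimage x) (preimage y)
    ; loopless = λ x → adjOrFalse-loopless H (preimage x)
    }

  sumFin-preimage : (h : Maybe (Fin s) → ℚ) → h nothing ≡ 0ℚ →
                    sumFin n (h ∘ preimage) ≡ sumFin s (h ∘ just)
  sumFin-preimage h h-nothing = begin
    sumFin n (h ∘ preimage)     ≡⟨ sumFin-image s e e-injective (h ∘ preimage)
                                     (λ k k∉e → trans (cong h (preimage-outside k∉e)) h-nothing) ⟩
    sumFin s (h ∘ preimage ∘ e) ≡⟨ sumFin-cong s (cong h ∘ preimage-image) ⟩
    sumFin s (h ∘ just)         ∎
    where open ≡-Reasoning

  open Setoid (≐-setoid n) using () renaming (refl to ≐-refl; sym to ≐-sym)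

  push-⊗ : ∀ N N′ → push N ⊗ push N′ ≐ push (N ⊗ N′)
  push-⊗ N N′ x y =
    trans (sumFin-preimage (λ p → entryOrZero N (preimage x) p ℚ.* entryOrZero N′ p (preimage y))
                           (*-zeroʳ (entryOrZero N (preimage x) nothing)))
          (entryOrZero-⊗ N N′ (preimage x) (preimage y))

  push-transpose : ∀ N → transpose (push N) ≐ push (transpose N)
  push-transpose N x y = entryOrZero-transpose N (preimage x) (preimage y)

  push-cong : ∀ {N N′} → N ≐ N′ → push N ≐ push N′
  push-cong N≐N′ x y with preimage x | preimage y
  ... | just a  | just b  = N≐N′ a b
  ... | just a  | nothing = refl
  ... | nothing | _       = refl

  laplacian-pushGraph : ∀ H → laplacian (pushGraph H) ≐ push (laplacian H)
  laplacian-pushGraph H x y with x Fin.≟ y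
  ... | yes refl = trans (sumFin-preimage (indicator ∘ adjOrFalse H (preimage x))
                                          (cong indicator (adjOrFalse-nothingʳ H (preimage x))))
                         (degree-entry (preimage x))
    where
    degree-entry : ∀ p → sumFin s (indicator ∘ adjOrFalse H p ∘ just) ≡ entryOrZero (laplacian H) p p
    degree-entry (just a) = sym (laplacian-diagonal H a)
    degree-entry nothing  = sumFin-zero s (λ _ → refl)
  ... | no x≢y = off-diagonal (preimage x) (preimage y) image-preimage image-preimage
    where
    off-diagonal : ∀ p q → (∀ {a} → p ≡ just a → e a ≡ x) → (∀ {b} → q ≡ just b → e b ≡ y) →
                   0ℚ ℚ.- indicator (adjOrFalse H p q) ≡ entryOrZero (laplacian H) p q
    off-diagonal (just a) (just b) ea≡x eb≡y = sym (laplacian-offDiagonal H λ { refl →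
                                                 x≢y (trans (sym (ea≡x refl)) (eb≡y refl)) })
    off-diagonal (just a) nothing  _ _ = refl
    off-diagonal nothing  _        _ _ = refl

  push-pseudoinverse : ∀ {A B} → IsPseudoinverse A B → IsPseudoinverse (push A) (push B)
  push-pseudoinverse {A} {B} (ABA , BAB , AB-sym , BA-sym) = ABA′ , BAB′ , AB-sym′ , BA-sym′
    where
    open import Relation.Binary.Reasoning.Setoid (≐-setoid n)
    ABA′ : (push A ⊗ push B) ⊗ push A ≐ push A
    ABA′ = begin
      (push A ⊗ push B) ⊗ push A ≈⟨ ⊗-cong (push-⊗ A B) ≐-refl ⟩
      push (A ⊗ B) ⊗ push A      ≈⟨ push-⊗ (A ⊗ B) A ⟩
      push ((A ⊗ B) ⊗ A)         ≈⟨ push-cong ABA ⟩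
      push A                     ∎
    BAB′ : (push B ⊗ push A) ⊗ push B ≐ push B
    BAB′ = begin
      (push B ⊗ push A) ⊗ push B ≈⟨ ⊗-cong (push-⊗ B A) ≐-refl ⟩
      push (B ⊗ A) ⊗ push B      ≈⟨ push-⊗ (B ⊗ A) B ⟩
      push ((B ⊗ A) ⊗ B)         ≈⟨ push-cong BAB ⟩
      push B                     ∎
    AB-sym′ : transpose (push A ⊗ push B) ≐ push A ⊗ push B
    AB-sym′ = begin
      transpose (push A ⊗ push B) ≈⟨ transpose-cong (push-⊗ A B) ⟩
      transpose (push (A ⊗ B))    ≈⟨ push-transpose (A ⊗ B) ⟩
      push (transpose (A ⊗ B))    ≈⟨ push-cong AB-sym ⟩
      push (A ⊗ B)                ≈⟨ ≐-sym (push-⊗ A B) ⟩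
      push A ⊗ push B             ∎
    BA-sym′ : transpose (push B ⊗ push A) ≐ push B ⊗ push A
    BA-sym′ = begin
      transpose (push B ⊗ push A) ≈⟨ transpose-cong (push-⊗ B A) ⟩
      transpose (push (B ⊗ A))    ≈⟨ push-transpose (B ⊗ A) ⟩
      push (transpose (B ⊗ A))    ≈⟨ push-cong BA-sym ⟩
      push (B ⊗ A)                ≈⟨ ≐-sym (push-⊗ B A) ⟩
      push B ⊗ push A             ∎

  pushGraph-resistance : ∀ {H M} → IsPseudoinverse (laplacian H) M →
                         ∀ x y → EffectiveResistance (pushGraph H) x y (quadDiff (push M) x y)
  pushGraph-resistance {H} pinv x y =
    push _ , IsPseudoinverse-respˡ (≐-sym (laplacian-pushGraph H)) (push-pseudoinverse pinv) , refl

goesFromTo : ∀ {n} → Fin n → Fin n → Fin n × Fin n → Bool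
goesFromTo x y (a , b) = does (x Fin.≟ a) ∧ does (y Fin.≟ b)

joins : ∀ {n} → Fin n → Fin n → Fin n × Fin n → Bool
joins x y e = goesFromTo x y e ∨ goesFromTo y x e

fromEdges : ∀ {n} → List (Fin n × Fin n) → SimpleGraph n
fromEdges es = record
  { adj      = λ x y → not (does (x Fin.≟ y)) ∧ any (joins x y) es
  ; sym      = λ x y → cong₂ (λ b c → not b ∧ c)
                 (does-⇔ (mk⇔ sym sym) (x Fin.≟ y) (y Fin.≟ x))
                 (cong or (map-cong (λ e → joins-sym x y e) es))
  ; loopless = λ x → cong (λ b → not b ∧ any (joins x x) es) (dec-true (x Fin.≟ x) refl)
  }
  where
  joins-sym : ∀ x y e → joins x y e ≡ joins y x e
  joins-sym x y e = ∨-comm (goesFromTo x y e) (goesFromTo y x e)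

scaledMatrix : ∀ {n} (d : ℕ) .{{_ : NonZero d}} → Vec (Vec ℤ n) n → Matrix n
scaledMatrix d rows i j = Vec.lookup (Vec.lookup rows i) j / d

module Gadgets where

  open import Agda.Builtin.FromNat using (Number; fromNat)
  open import Agda.Builtin.FromNeg using (Negative; fromNeg)
  import Data.Fin.Literals as FinLiterals
  import Data.Integer.Literals as ℤLiterals
  import Data.Nat.Literals as ℕLiterals
  open import Data.Unit using (⊤; tt)

  instance
    unit-instance : ⊤
    unit-instance = tt
    ℕ-number : Number ℕ
    ℕ-number = ℕLiterals.number
    ℤ-number : Number ℤ
    ℤ-number = ℤLiterals.number
    ℤ-negative : Negative ℤ
    ℤ-negative = ℤLiterals.negative
    Fin-number : ∀ {n} → Number (Fin n)
    Fin-number {n} = FinLiterals.number n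

  separatedGadget joinedGadget : SimpleGraph 6
  separatedGadget = fromEdges ((0 , 2) ∷ (0 , 5) ∷ (1 , 2) ∷ (1 , 5) ∷ (2 , 3) ∷ (2 , 4) ∷ [])
  joinedGadget    = fromEdges ((0 , 1) ∷ (0 , 4) ∷ (0 , 5) ∷ (1 , 2) ∷ (2 , 3) ∷ [])

  separatedGadget⁺ joinedGadget⁺ : Matrix 6
  separatedGadget⁺ = scaledMatrix 36
    ( (16 ∷ -2 ∷ -2 ∷ -8 ∷ -8 ∷ 4 ∷ [])
    ∷ (-2 ∷ 16 ∷ -2 ∷ -8 ∷ -8 ∷ 4 ∷ [])
    ∷ (-2 ∷ -2 ∷ 7 ∷ 1 ∷ 1 ∷ -5 ∷ [])
    ∷ (-8 ∷ -8 ∷ 1 ∷ 31 ∷ -5 ∷ -11 ∷ [])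
    ∷ (-8 ∷ -8 ∷ 1 ∷ -5 ∷ 31 ∷ -11 ∷ [])
    ∷ (4 ∷ 4 ∷ -5 ∷ -11 ∷ -11 ∷ 19 ∷ [])
    ∷ [])
  joinedGadget⁺ = scaledMatrix 18
    ( (8 ∷ -1 ∷ -7 ∷ -10 ∷ 5 ∷ 5 ∷ [])
    ∷ (-1 ∷ 8 ∷ 2 ∷ -1 ∷ -4 ∷ -4 ∷ [])
    ∷ (-7 ∷ 2 ∷ 14 ∷ 11 ∷ -10 ∷ -10 ∷ [])
    ∷ (-10 ∷ -1 ∷ 11 ∷ 26 ∷ -13 ∷ -13 ∷ [])
    ∷ (5 ∷ -4 ∷ -10 ∷ -13 ∷ 20 ∷ 2 ∷ [])
    ∷ (5 ∷ -4 ∷ -10 ∷ -13 ∷ 2 ∷ 20 ∷ [])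
    ∷ [])

  separatedGadget-pseudoinverse : IsPseudoinverse (laplacian separatedGadget) separatedGadget⁺
  separatedGadget-pseudoinverse =
    from-yes (isPseudoinverse? (laplacian separatedGadget) separatedGadget⁺)

  joinedGadget-pseudoinverse : IsPseudoinverse (laplacian joinedGadget) joinedGadget⁺
  joinedGadget-pseudoinverse =
    from-yes (isPseudoinverse? (laplacian joinedGadget) joinedGadget⁺)

open Gadgets

uvBlock : Matrix 6 → Matrix 2
uvBlock M a b = M (a ↑ˡ 4) (b ↑ˡ 4)

gadget-uvBlocks : uvBlock joinedGadget⁺ ≐ uvBlock separatedGadget⁺
gadget-uvBlocks = from-yes (uvBlock joinedGadget⁺ ≐? uvBlock separatedGadget⁺)

module _ {n : ℕ} {A : Set} where

  runLength : (Fin n → Fin n → A) → Tree n A → ℕ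
  runLength ans (leaf _)      = zero
  runLength ans (query x y f) = suc (runLength ans (f (ans x y)))

  output : (Fin n → Fin n → A) → Tree n A → Bool
  output ans (leaf b)      = b
  output ans (query x y f) = output ans (f (ans x y))

  run : {O : Oracle n A} (ans : Fin n → Fin n → A) → (∀ x y → O x y (ans x y)) →
        ∀ t → Run O t (runLength ans t) (output ans t)
  run ans valid (leaf b)      = done
  run ans valid (query x y f) = ask (valid x y) (run ans valid (f (ans x y)))

  queried : (Fin n → Fin n → A) → ℕ → Tree n A → List (Fin n)
  queried ans zero    t             = []
  queried ans (suc p) (leaf _)      = []
  queried ans (suc p) (query x y f) = x ∷ y ∷ queried ans p (f (ans x y))

  length-queried : ∀ ans p t → length (queried ans p t) ≤ 2 * p
  length-queried ans zero    t             = z≤n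
  length-queried ans (suc p) (leaf _)      = z≤n
  length-queried ans (suc p) (query x y f) =
    subst (length (queried ans (suc p) (query x y f)) ≤_) (sym (*-suc 2 p))
          (s≤s (s≤s (length-queried ans p (f (ans x y)))))

  output-agrees : ∀ {ans D} p t →
                  (∀ {x y} → x ∈ queried D p t → y ∈ queried D p t → ans x y ≡ D x y) →
                  runLength ans t < p → output ans t ≡ output D t
  output-agrees (suc p) (leaf b)      agree _ = refl
  output-agrees {D = D} (suc p) (query x y f) agree (s≤s len<p)
    rewrite agree (here refl) (there (here refl)) =
    output-agrees p (f (D x y)) (λ x∈ y∈ → agree (there (there x∈)) (there (there y∈))) len<p

module _ {n : ℕ} where

  open import Data.List.Membership.DecPropositional (Fin._≟_ {n}) using (_∈?_)

  ∉-exists : (L : List (Fin n)) → length L < n → ∃ λ x → x ∉ L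
  ∉-exists L |L|<n = ¬∀⟶∃¬ n (_∈ L) (_∈? L) ¬all∈
    where
    ¬all∈ : ¬ (∀ x → x ∈ L)
    ¬all∈ all∈ with pigeonhole |L|<n (index ∘ all∈)
    ... | i , j , i<j , same-index = <⇒≢ i<j (begin
      i                            ≡⟨ lookup-index (all∈ i) ⟩
      lookup L (index (all∈ i))    ≡⟨ cong (lookup L) same-index ⟩
      lookup L (index (all∈ j))    ≡⟨ sym (lookup-index (all∈ j)) ⟩
      j                            ∎)
      where open ≡-Reasoning

injective-∷ᶠ : ∀ {s n} {x : Fin n} {f : Fin s → Fin n} → Injective _≡_ _≡_ f →
              (∀ a → f a ≢ x) → Injective _≡_ _≡_ (x ∷ᶠ f)
injective-∷ᶠ f-inj f∌x {zero}  {zero}  _  = refl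
injective-∷ᶠ f-inj f∌x {zero}  {suc b} eq = contradiction (sym eq) (f∌x b)
injective-∷ᶠ f-inj f∌x {suc a} {zero}  eq = contradiction eq (f∌x a)
injective-∷ᶠ f-inj f∌x {suc a} {suc b} eq = cong suc (f-inj eq)

freshInjection : ∀ {n} s (L : List (Fin n)) → s + length L ≤ n →
                 Σ (Fin s → Fin n) λ w → Injective _≡_ _≡_ w × (∀ a → w a ∉ L)
freshInjection zero    L _     = (λ ()) , (λ { {()} }) , (λ ())
freshInjection {n} (suc s) L bound with ∉-exists L (≤-trans (s≤s (m≤n+m (length L) s)) bound)
... | x , x∉L with freshInjection s (x ∷ L) (subst (_≤ n) (sym (+-suc s (length L))) bound)
... | w , w-inj , w∉x∷L =
  x ∷ᶠ w , injective-∷ᶠ w-inj (λ a wa≡x → w∉x∷L a (here wa≡x)) ,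
  λ { zero → x∉L ; (suc a) → w∉x∷L a ∘ there }

module ResistanceLowerBound {n k : ℕ} {T : Fin n → Fin n → Tree n ℚ}
         (tests : TestsAdjacency EROracle k T) {u v : Fin n} (u≢v : u ≢ v) where

  role : Fin n → Maybe (Fin 2)
  role x with x Fin.≟ u | x Fin.≟ v
  ... | yes _ | _     = just zero
  ... | no  _ | yes _ = just (suc zero)
  ... | no  _ | no  _ = nothing

  -- Wherever the gadgets are later planted, both planted graphs give these answers to
  -- every query that avoids the four planted vertices other than u and v.
  baseAnswer : Fin n → Fin n → ℚ
  baseAnswer = quadDiff (λ x y → entryOrZero (uvBlock separatedGadget⁺) (role x) (role y))

  touched : List (Fin n)
  touched = queried baseAnswer (suc k) (T u v)

  module Planted (w : Fin 4 → Fin n) (w-injective : Injective _≡_ _≡_ w)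
                 (w-fresh : ∀ a → w a ∉ u ∷ v ∷ touched) where

    e-injective : Injective _≡_ _≡_ (u ∷ᶠ v ∷ᶠ w)
    e-injective = injective-∷ᶠ (injective-∷ᶠ w-injective (λ a → w-fresh a ∘ there ∘ here))
                               λ { zero → u≢v ∘ sym ; (suc a) → w-fresh a ∘ here }

    open Embedding (u ∷ᶠ v ∷ᶠ w) e-injective

    preimage-role : ∀ {x} → (∀ a → w a ≢ x) → preimage x ≡ map (_↑ˡ 4) (role x)
    preimage-role {x} x∉w with x Fin.≟ u | x Fin.≟ v
    ... | yes refl | _        = preimage-image zero
    ... | no  x≢u  | yes refl = preimage-image (suc zero)
    ... | no  x≢u  | no  x≢v  = preimage-outside
      λ { zero → x≢u ∘ sym ; (suc zero) → x≢v ∘ sym ; (suc (suc a)) → x∉w a }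

    touched-∉w : ∀ {x} → x ∈ touched → ∀ a → w a ≢ x
    touched-∉w x∈ a refl = w-fresh a (there (there x∈))

    push-agrees : ∀ {M} → uvBlock M ≐ uvBlock separatedGadget⁺ →
                  ∀ {x y} → x ∈ touched → y ∈ touched →
                  push M x y ≡ entryOrZero (uvBlock separatedGadget⁺) (role x) (role y)
    push-agrees {M} block {x} {y} x∈ y∈ = begin
      entryOrZero M (preimage x) (preimage y)
        ≡⟨ cong₂ (entryOrZero M) (preimage-role (touched-∉w x∈)) (preimage-role (touched-∉w y∈)) ⟩
      entryOrZero M (map (_↑ˡ 4) (role x)) (map (_↑ˡ 4) (role y))
        ≡⟨ entryOrZero-map (_↑ˡ 4) M (role x) (role y) ⟩
      entryOrZero (uvBlock M) (role x) (role y)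
        ≡⟨ entryOrZero-cong block (role x) (role y) ⟩
      entryOrZero (uvBlock separatedGadget⁺) (role x) (role y) ∎
      where open ≡-Reasoning

    output-base≡adj : ∀ {H M} → IsPseudoinverse (laplacian H) M →
                      uvBlock M ≐ uvBlock separatedGadget⁺ →
                      output baseAnswer (T u v) ≡ adj H zero (suc zero)
    output-base≡adj {H} {M} pinv block = begin
      output baseAnswer (T u v) ≡⟨ output-agrees (suc k) (T u v) answers-agree (s≤s (proj₁ outcome)) ⟨
      output answer (T u v)     ≡⟨ ≡true-⇔⇒≡ (proj₂ outcome) ⟩
      adj (pushGraph H) u v     ≡⟨ cong₂ (adjOrFalse H) (preimage-image zero) (preimage-image (suc zero)) ⟩
      adj H zero (suc zero)     ∎
      where
      open ≡-Reasoning
      answer : Fin n → Fin n → ℚ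
      answer = quadDiff (push M)
      answers-agree : ∀ {x y} → x ∈ touched → y ∈ touched → answer x y ≡ baseAnswer x y
      answers-agree x∈ y∈ =
        cong₂ ℚ._+_ (cong₂ ℚ._-_ (cong₂ ℚ._-_ (push-agrees block x∈ x∈) (push-agrees block x∈ y∈))
                                 (push-agrees block y∈ x∈))
                    (push-agrees block y∈ y∈)
      outcome : runLength answer (T u v) ≤ k ×
                ((output answer (T u v) ≡ true) ⇔ Adjacent (pushGraph H) u v)
      outcome = proj₂ (tests (pushGraph H) u v) _ _ (run answer (pushGraph-resistance pinv) (T u v))

    absurd : ⊥
    absurd = case trans (sym output-separatedGadget) output-joinedGadget of λ ()
      where
      output-separatedGadget : output baseAnswer (T u v) ≡ false
      output-separatedGadget = output-base≡adj separatedGadget-pseudoinverse (λ _ _ → refl)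
      output-joinedGadget : output baseAnswer (T u v) ≡ true
      output-joinedGadget = output-base≡adj joinedGadget-pseudoinverse gadget-uvBlocks

  vertexBound : n < 6 + 2 * suc k
  vertexBound = decidable-stable (n <? 6 + 2 * suc k) λ n≮bound →
    let w , w-injective , w-fresh = freshInjection 4 (u ∷ v ∷ touched)
              (≤-trans (+-monoʳ-≤ 6 (length-queried baseAnswer (suc k) (T u v))) (≮⇒≥ n≮bound))
    in  Planted.absurd w w-injective w-fresh

distinct-lookup : ∀ {A : Set} {xs : List A} → Unique xs →
                  ∀ {i j} → i Fin.< j → lookup xs i ≢ lookup xs j
distinct-lookup (x∉xs ∷ _)    {zero}  {suc j} _         = All.lookup x∉xs (∈-lookup j)
distinct-lookup (_ ∷ unique) {suc i} {suc j} (s≤s i<j) = distinct-lookup unique i<j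

length-unique : ∀ {n} {xs : List (Fin n)} → Unique xs → length xs ≤ n
length-unique {n} {xs} unique = decidable-stable (length xs ≤? n) λ |xs|≰n →
  let i , j , i<j , same = pigeonhole (≰⇒> |xs|≰n) (lookup xs)
  in  distinct-lookup unique i<j same

leastOrNone : ∀ {P : ℕ → Set} → Decidable P → ∀ B →
              (∃ λ d → P d × (∀ k → k < d → ¬ P k)) ⊎ (∀ k → k < B → ¬ P k)
leastOrNone P? zero    = inj₂ (λ _ ())
leastOrNone P? (suc B) with leastOrNone P? B
... | inj₁ least     = inj₁ least
... | inj₂ none<B with P? B
...   | yes pB = inj₁ (B , pB , none<B)
...   | no ¬pB = inj₂ λ k k<1+B → case m<1+n⇒m<n∨m≡n k<1+B of λ
                   { (inj₁ k<B) → none<B k k<B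
                   ; (inj₂ refl) → ¬pB }

module _ {n : ℕ} (G : SimpleGraph n) where

  open import Data.List.Membership.DecPropositional (Fin._≟_ {n}) using (_∈?_)

  walk? : ∀ k x z → Dec (Walk G x z k)
  walk? zero    x z = map′ (λ { refl → here }) (λ { here → refl }) (x Fin.≟ z)
  walk? (suc k) x z = map′ (λ (y , xy , w) → step xy w) (λ { (step xy w) → _ , xy , w })
                           (any? λ y → (adj G x y Bool.≟ true) ×-dec walk? k y z)

  vertices : ∀ {x z k} → Walk G x z k → List (Fin n)
  vertices (here {x})     = x ∷ []
  vertices (step {x} _ w) = x ∷ vertices w

  length-vertices : ∀ {x z k} (w : Walk G x z k) → length (vertices w) ≡ suc k
  length-vertices here       = refl
  length-vertices (step _ w) = cong suc (length-vertices w)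

  walkFrom : ∀ {x y z k} (w : Walk G y z k) → x ∈ vertices w → ∃ λ k′ → k′ ≤ k × Walk G x z k′
  walkFrom here       (here refl) = _ , z≤n , here
  walkFrom (step a w) (here refl) = _ , ≤-refl , step a w
  walkFrom (step a w) (there x∈w) =
    let k′ , k′≤k , w′ = walkFrom w x∈w in k′ , m≤n⇒m≤1+n k′≤k , w′

  shorterOrSimple : ∀ {x z k} (w : Walk G x z k) →
                    (∃ λ k′ → k′ < k × Walk G x z k′) ⊎ Unique (vertices w)
  shorterOrSimple here = inj₂ ([] ∷ [])
  shorterOrSimple (step {x} a w) with shorterOrSimple w
  ... | inj₁ (k′ , k′<k , w′) = inj₁ (suc k′ , s≤s k′<k , step a w′)
  ... | inj₂ simple with x ∈? vertices w
  ...   | yes x∈w = let k′ , k′≤k , w′ = walkFrom w x∈w in inj₁ (k′ , s≤s k′≤k , w′)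
  ...   | no  x∉w = inj₂ (¬Any⇒All¬ (vertices w) x∉w ∷ simple)

  walkBelow-n : ∀ {x z k} → Acc _<_ k → Walk G x z k → ∃ λ k′ → k′ < n × Walk G x z k′
  walkBelow-n (acc shorter) w with shorterOrSimple w
  ... | inj₁ (k′ , k′<k , w′) = walkBelow-n (shorter k′<k) w′
  ... | inj₂ simple           = _ , subst (_≤ n) (length-vertices w) (length-unique simple) , w

  shortestPath : ∀ x z → ∃ (ShortestPath G x z)
  shortestPath x z with leastOrNone (λ d → walk? d x z) n
  ... | inj₁ (d , w , minimal) = just d , w , minimal
  ... | inj₂ none<n            = nothing , λ k w →
    let k′ , k′<n , w′ = walkBelow-n (<-wellFounded k) w in none<n k′ k′<n w′

isOne : Maybe ℕ → Bool
isOne (just 1) = true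
isOne _        = false

adjacencyTree : ∀ {n} → Fin n → Fin n → Tree n (Maybe ℕ)
adjacencyTree u v = query u v (leaf ∘ isOne)

isOne⇔adjacent : ∀ {n} (G : SimpleGraph n) {u v d} → ShortestPath G u v d →
                 (isOne d ≡ true) ⇔ Adjacent G u v
isOne⇔adjacent G {d = just zero} (here , _) =
  mk⇔ (λ ()) (λ uu → case trans (sym (loopless G _)) uu of λ ())
isOne⇔adjacent G {d = just 1} (step uv here , _) = mk⇔ (const uv) (const refl)
isOne⇔adjacent G {d = just (suc (suc d))} (_ , minimal) =
  mk⇔ (λ ()) (λ uv → contradiction (step uv here) (minimal 1 (s≤s (s≤s z≤n))))
isOne⇔adjacent G {d = nothing} none = mk⇔ (λ ()) (λ uv → contradiction (step uv here) (none 1))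

adjacencyTree-tests : ∀ n → TestsAdjacency SPOracle 1 (adjacencyTree {n})
adjacencyTree-tests n G u v =
  (let d , sp = shortestPath G u v in 1 , isOne d , ask sp done) ,
  λ { .1 .(isOne d) (ask {a = d} sp done) → s≤s z≤n , isOne⇔adjacent G sp }

linearBound : ∀ {n k} → 8 ≤ n → n < 6 + 2 * suc k → n ≤ 10 * k
linearBound {k = zero}  8≤n n<8     = contradiction n<8 (≤⇒≯ 8≤n)
linearBound {n} {suc m} _   n<bound = <⇒≤ (begin-strict
  n                   <⟨ n<bound ⟩
  6 + 2 * suc (suc m) ≡⟨ cong (6 +_) (trans (*-suc 2 (suc m)) (cong (2 +_) (*-suc 2 m))) ⟩
  10 + 2 * m          ≤⟨ +-monoʳ-≤ 10 (*-monoˡ-≤ m (m≤m+n 2 8)) ⟩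
  10 + 10 * m         ≡⟨ *-suc 10 m ⟨
  10 * suc m          ∎)
  where open ≤-Reasoning

resistanceQueries-linear : ∀ n → 8 ≤ n → ∀ k (T : Fin n → Fin n → Tree n ℚ) →
                           TestsAdjacency EROracle k T → n ≤ 10 * k
resistanceQueries-linear (suc zero)    (s≤s ()) _ _ _
resistanceQueries-linear (suc (suc n)) 8≤n      k T tests =
  linearBound 8≤n (ResistanceLowerBound.vertexBound tests {zero} {suc zero} λ ())

mainTheorem9 :
    (∀ (n : ℕ) → Σ (Fin n → Fin n → Tree n (Maybe ℕ)) λ T →
        TestsAdjacency SPOracle 1 T)
    ×
    (∃ λ (c : ℕ) → ∃ λ (n₀ : ℕ) →
      ∀ (n : ℕ) → n₀ ≤ n → ∀ (k : ℕ) (T : Fin n → Fin n → Tree n ℚ) →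
        TestsAdjacency EROracle k T → n ≤ suc c * k)
mainTheorem9 = (λ n → adjacencyTree , adjacencyTree-tests n) , 9 , 8 , resistanceQueries-linear
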